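{- Let $Q$ be a commutative involutive quantale and $A$ a set. Suppose $\mathbf{A}$ is an object of $\mathbf{Rel}_Q\text{ - }\mathbf{Alg}_{\mathrm{vN}}(A)$ with $\mathbf{A}=e_1\mathbf{A}\oplus e_2\mathbf{A}$, where $e_1,e_2\in\mathbf{A}$ are orthogonal idempotents with $e_1+e_2=\mathrm{id}_A$ and $e_1$ is the identity on a subset $E\subseteq A$ (i.e. $e_1(x,y)=1_Q$ if $x=y\in E$ and $0$ otherwise). Then $e_1\mathbf{A}$, viewed (by restriction to $E\times E$) as a subset of $\mathrm{Hom}(E,E)$, is an object of $\mathbf{Rel}_Q\text{ - }\mathbf{Alg}_{\mathrm{vN}}(E)$.
   Context: A commutative involutive quantale $Q$ is a complete join-semilattice with a commutative monoid operation $\cdot$ (unit $1_Q$) distributing over arbitrary joins, and a join-preserving involution ${}^*$ with $(xy)^*=y^*x^*$, $1_Q^*=1_Q$; its least element is $0\neq\top$. In $\mathbf{Rel}_Q$, objects are sets, morphisms $X\to Y$ are functions $X\times Y\to Q$, composition $(g\circ f)(x,z)=\bigvee_y f(x,y)g(y,z)$, identities $\mathrm{id}_X(x,y)=1_Q$ iff $x=y$ (else $0$), dagger $f^\dagger(y,x)=f(x,y)^*$, addition $+$ is pointwise join, scalar multiplication pointwise. $\mathbf{Rel}_Q\text{ - }\mathbf{Alg}_{\mathrm{vN}}(X)$ has as objects the subsets $\mathbf{C}\subseteq\mathrm{Hom}(X,X)$ containing the zero map and $\mathrm{id}_X$, closed under binary joins, composition, scalar multiplication and $\dagger$, commutative under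 composition, and satisfying $\mathbf{C}=\mathbf{C}''$, where $D'=\{f:f\circ g=g\circ f\ \forall g\in D\}$. For an idempotent $e\in\mathbf{A}$, $e\mathbf{A}=\{e\circ f:f\in\mathbf{A}\}$; $\mathbf{A}=e_1\mathbf{A}\oplus e_2\mathbf{A}$ means every $f\in\mathbf{A}$ equals $e_1\circ f+e_2\circ f$ and $\mathbf{A}$ is the direct sum of these two subsemialgebras. -}

module Defs where

open import Data.Bool using (Bool; true; false)
open import Data.Empty using (⊥)
open import Data.Product using (Σ; _×_; _,_; proj₁)
open import Relation.Binary.PropositionalEquality using (_≡_)
open import Relation.Binary.Structures using (IsPartialOrder)
open import Relation.Nullary using (¬_)
open import Algebra.Structures using (IsCommutativeMonoid)

-- Commutative involutive quantale (carrier a type; joins indexed by arbitrary types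
-- in Set, which covers joins of arbitrary subsets of the carrier).
record CIQuantale : Set₁ where
  infixl 7 _·_
  field
    Carrier   : Set
    _≤_       : Carrier → Carrier → Set
    ≤-isPartialOrder : IsPartialOrder _≡_ _≤_
    ⋁         : {I : Set} → (I → Carrier) → Carrier
    ⋁-upper   : ∀ {I : Set} (f : I → Carrier) (i : I) → f i ≤ ⋁ f
    ⋁-least   : ∀ {I : Set} (f : I → Carrier) (x : Carrier) → (∀ i → f i ≤ x) → ⋁ f ≤ x
    _·_       : Carrier → Carrier → Carrier
    1Q        : Carrier
    ·-isCommutativeMonoid : IsCommutativeMonoid _≡_ _·_ 1Q
    ·-distribˡ-⋁ : ∀ (x : Carrier) {I : Set} (f : I → Carrier) → x · ⋁ f ≡ ⋁ (λ i → x · f i)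
    ·-distribʳ-⋁ : ∀ (x : Carrier) {I : Set} (f : I → Carrier) → ⋁ f · x ≡ ⋁ (λ i → f i · x)
    _*        : Carrier → Carrier
    *-involutive : ∀ x → (x *) * ≡ x
    *-⋁       : ∀ {I : Set} (f : I → Carrier) → (⋁ f) * ≡ ⋁ (λ i → f i *)
    *-·       : ∀ x y → (x · y) * ≡ (y *) · (x *)
    *-1       : 1Q * ≡ 1Q
    0≢⊤       : ¬ (⋁ {⊥} (λ ()) ≡ ⋁ {Carrier} (λ x → x))

  0Q : Carrier
  0Q = ⋁ {⊥} (λ ())

  _∨_ : Carrier → Carrier → Carrier
  x ∨ y = ⋁ {Bool} (λ { true → x ; false → y })

module RelQ (Q : CIQuantale) where
  open CIQuantale Q public

  Hom : Set → Set → Set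
  Hom X Y = X → Y → Carrier

  _≐_ : ∀ {X Y} → Hom X Y → Hom X Y → Set
  f ≐ g = ∀ x y → f x y ≡ g x y

  _∘R_ : ∀ {X Y Z} → Hom Y Z → Hom X Y → Hom X Z
  _∘R_ {Y = Y} g f x z = ⋁ {Y} (λ y → f x y · g y z)

  -- identity: 1_Q if x = y, else 0 (as the join over proofs of x ≡ y)
  idR : ∀ X → Hom X X
  idR X x y = ⋁ {x ≡ y} (λ _ → 1Q)

  zeroR : ∀ {X Y} → Hom X Y
  zeroR x y = 0Q

  _⊹_ : ∀ {X Y} → Hom X Y → Hom X Y → Hom X Y
  (f ⊹ g) x y = f x y ∨ g x y

  _⊙_ : ∀ {X Y} → Carrier → Hom X Y → Hom X Y
  (q ⊙ f) x y = q · f x y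

  _† : ∀ {X Y} → Hom X Y → Hom Y X
  (f †) y x = f x y *

  Sub : Set → Set₁
  Sub X = Hom X X → Set

  _′ : ∀ {X} → Sub X → Sub X
  (D ′) f = ∀ g → D g → (f ∘R g) ≐ (g ∘R f)

  record IsVNAlg (X : Set) (C : Sub X) : Set₁ where
    field
      zero∈  : C zeroR
      id∈    : C (idR X)
      ⊹-closed : ∀ f g → C f → C g → C (f ⊹ g)
      ∘-closed : ∀ f g → C f → C g → C (g ∘R f)
      ⊙-closed : ∀ q f → C f → C (q ⊙ f)
      †-closed : ∀ f → C f → C (f †)
      commutative : ∀ f g → C f → C g → (f ∘R g) ≐ (g ∘R f)
      bicommutant⊆ : ∀ f → C f → ((C ′) ′) f
      bicommutant⊇ : ∀ f → ((C ′) ′) f → C f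

  _·Sub_ : ∀ {X} → Hom X X → Sub X → Sub X
  (e ·Sub 𝐀) g = Σ (Hom _ _) (λ f → 𝐀 f × (g ≐ (e ∘R f)))

  record IsDirectSum {X : Set} (𝐀 : Sub X) (e₁ e₂ : Hom X X) : Set₁ where
    field
      decompose : ∀ f → 𝐀 f → f ≐ ((e₁ ∘R f) ⊹ (e₂ ∘R f))
      unique : ∀ g₁ g₂ h₁ h₂ → (e₁ ·Sub 𝐀) g₁ → (e₂ ·Sub 𝐀) g₂ →
               (e₁ ·Sub 𝐀) h₁ → (e₂ ·Sub 𝐀) h₂ →
               (g₁ ⊹ g₂) ≐ (h₁ ⊹ h₂) → (g₁ ≐ h₁) × (g₂ ≐ h₂)

  restrict : ∀ {A : Set} (E : A → Set) → Sub A → Sub (Σ A E)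
  restrict E S h = Σ (Hom _ _) (λ g → S g × (∀ x y → h x y ≡ g (proj₁ x) (proj₁ y)))

-- Let ι : E → A be the graph of the inclusion of E, a morphism of Rel_Q with
-- ι† ∘ ι = id_E and ι ∘ ι† = e₁. Restriction to E × E is k ↦ ι† ∘ k ∘ ι, and it
-- sends e₁ ∘ f and f to the same map, so e₁𝐀 and 𝐀 have the same restrictions.
-- Because e₁ ∈ 𝐀, everything in 𝐀 and in 𝐀′ commutes with e₁, and on such maps
-- restriction is multiplicative; this gives the algebra structure, and shows that
-- restrictions of 𝐀′ lie in the commutant of the restricted algebra. Hence an h in
-- its bicommutant extends to ι ∘ h ∘ ι†, which commutes with 𝐀′, so lies in 𝐀, and
-- restricts back to h.
module Submission where

open import Defs
open import Data.Product using (Σ; _×_; _,_; proj₁; proj₂)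
open import Function.Bundles using (_⇔_; mk⇔; Equivalence)
open import Function.Definitions using (Injective)
open import Relation.Binary.Bundles using (Setoid)
open import Relation.Binary.PropositionalEquality using (_≡_; refl; sym; trans; cong; cong₂)
open import Relation.Binary.Structures using (IsPartialOrder)
open import Algebra.Structures using (IsCommutativeMonoid)
import Relation.Binary.Reasoning.Setoid as SetoidReasoning

module Quantale (Q : CIQuantale) where
  open CIQuantale Q
  open IsPartialOrder ≤-isPartialOrder using (antisym; reflexive) renaming (refl to ≤-refl; trans to ≤-trans)
  open IsCommutativeMonoid ·-isCommutativeMonoid using (identityˡ; identityʳ)

  ⟦_⟧ : Set → Carrier
  ⟦ P ⟧ = ⋁ {P} (λ _ → 1Q)

  ⋁-mono : ∀ {I : Set} {f g : I → Carrier} → (∀ i → f i ≤ g i) → ⋁ f ≤ ⋁ g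
  ⋁-mono {f = f} {g} f≤g = ⋁-least f (⋁ g) (λ i → ≤-trans (f≤g i) (⋁-upper g i))

  ⋁-cong : ∀ {I : Set} {f g : I → Carrier} → (∀ i → f i ≡ g i) → ⋁ f ≡ ⋁ g
  ⋁-cong f≡g = antisym (⋁-mono (λ i → reflexive (f≡g i))) (⋁-mono (λ i → reflexive (sym (f≡g i))))

  ⋁-Σ : ∀ {I : Set} {J : I → Set} (f : (i : I) → J i → Carrier) →
        ⋁ (λ i → ⋁ (f i)) ≡ ⋁ {Σ I J} (λ s → f (proj₁ s) (proj₂ s))
  ⋁-Σ f = antisym
    (⋁-least _ _ (λ i → ⋁-least _ _ (λ j → ⋁-upper _ (i , j))))
    (⋁-least _ _ (λ { (i , j) → ≤-trans (⋁-upper (f i) j) (⋁-upper _ i) }))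

  ⋁-swap : ∀ {I J : Set} (f : I → J → Carrier) →
           ⋁ (λ i → ⋁ (λ j → f i j)) ≡ ⋁ (λ j → ⋁ (λ i → f i j))
  ⋁-swap f = antisym (swap≤ f) (swap≤ (λ j i → f i j))
    where
    swap≤ : ∀ {I J : Set} (g : I → J → Carrier) → ⋁ (λ i → ⋁ (λ j → g i j)) ≤ ⋁ (λ j → ⋁ (λ i → g i j))
    swap≤ g = ⋁-least _ _ (λ i → ⋁-least _ _ (λ j →
      ≤-trans (⋁-upper (λ i′ → g i′ j) i) (⋁-upper _ j)))

  ⋁-onePoint : ∀ {Y : Set} {a : Y} (c : Y → Carrier) → ⋁ (λ y → ⋁ {a ≡ y} (λ _ → c y)) ≡ c a
  ⋁-onePoint {a = a} c = antisym
    (⋁-least _ _ (λ y → ⋁-least _ _ (λ { refl → ≤-refl })))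
    (≤-trans (⋁-upper (λ _ → c a) refl) (⋁-upper _ a))

  ⟦⟧-·ˡ : ∀ (P : Set) (c : Carrier) → ⟦ P ⟧ · c ≡ ⋁ {P} (λ _ → c)
  ⟦⟧-·ˡ P c = trans (·-distribʳ-⋁ c _) (⋁-cong (λ _ → identityˡ c))

  ⟦⟧-·ʳ : ∀ (P : Set) (c : Carrier) → c · ⟦ P ⟧ ≡ ⋁ {P} (λ _ → c)
  ⟦⟧-·ʳ P c = trans (·-distribˡ-⋁ c _) (⋁-cong (λ _ → identityʳ c))

  ⟦⟧-·-⟦⟧ : ∀ (P R : Set) → ⟦ P ⟧ · ⟦ R ⟧ ≡ ⟦ P × R ⟧
  ⟦⟧-·-⟦⟧ P R = trans (⟦⟧-·ˡ P ⟦ R ⟧) (⋁-Σ (λ _ _ → 1Q))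

  ⟦⟧-* : ∀ (P : Set) → ⟦ P ⟧ * ≡ ⟦ P ⟧
  ⟦⟧-* P = trans (*-⋁ _) (⋁-cong (λ _ → *-1))

  ⟦⟧-cong : ∀ {P R : Set} → P ⇔ R → ⟦ P ⟧ ≡ ⟦ R ⟧
  ⟦⟧-cong P⇔R = antisym
    (⋁-least _ _ (λ p → ⋁-upper _ (Equivalence.to P⇔R p)))
    (⋁-least _ _ (λ r → ⋁-upper _ (Equivalence.from P⇔R r)))

module Relations (Q : CIQuantale) where
  open RelQ Q public
  open Quantale Q public
  open IsCommutativeMonoid ·-isCommutativeMonoid using (assoc)

  ≐-setoid : Set → Set → Setoid _ _
  ≐-setoid X Y = record
    { Carrier = Hom X Y
    ; _≈_ = _≐_
    ; isEquivalence = record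
      { refl = λ _ _ → refl
      ; sym = λ f≐g x y → sym (f≐g x y)
      ; trans = λ f≐g g≐h x y → trans (f≐g x y) (g≐h x y)
      }
    }

  module ≐-Reasoning {X Y : Set} = SetoidReasoning (≐-setoid X Y)

  commutant-antitone : ∀ {X} {C D : Sub X} → (∀ f → C f → D f) → ∀ g → (D ′) g → (C ′) g
  commutant-antitone C⊆D g g∈D′ f f∈C = g∈D′ f (C⊆D f f∈C)

  ⊆-bicommutant : ∀ {X} {C : Sub X} f → C f → ((C ′) ′) f
  ⊆-bicommutant f f∈C g g∈C′ x y = sym (g∈C′ f f∈C x y)

  IsVNAlg-cong : ∀ {X} {C D : Sub X} → (∀ f → C f → D f) → (∀ f → D f → C f) →
                 IsVNAlg X C → IsVNAlg X D
  IsVNAlg-cong {C = C} {D} C⊆D D⊆C V = record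
    { zero∈ = C⊆D _ zero∈
    ; id∈ = C⊆D _ id∈
    ; ⊹-closed = λ f g f∈ g∈ → C⊆D _ (⊹-closed f g (D⊆C f f∈) (D⊆C g g∈))
    ; ∘-closed = λ f g f∈ g∈ → C⊆D _ (∘-closed f g (D⊆C f f∈) (D⊆C g g∈))
    ; ⊙-closed = λ q f f∈ → C⊆D _ (⊙-closed q f (D⊆C f f∈))
    ; †-closed = λ f f∈ → C⊆D _ (†-closed f (D⊆C f f∈))
    ; commutative = λ f g f∈ g∈ → commutative f g (D⊆C f f∈) (D⊆C g g∈)
    ; bicommutant⊆ = ⊆-bicommutant
    ; bicommutant⊇ = λ f f∈ → C⊆D f (bicommutant⊇ f
        (commutant-antitone (commutant-antitone D⊆C) f f∈))
    }
    where open IsVNAlg V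

  ∘R-congˡ : ∀ {X Y Z} (g : Hom Y Z) {f f′ : Hom X Y} → f ≐ f′ → (g ∘R f) ≐ (g ∘R f′)
  ∘R-congˡ g f≐f′ x z = ⋁-cong (λ y → cong (_· g y z) (f≐f′ x y))

  ∘R-congʳ : ∀ {X Y Z} {g g′ : Hom Y Z} (f : Hom X Y) → g ≐ g′ → (g ∘R f) ≐ (g′ ∘R f)
  ∘R-congʳ f g≐g′ x z = ⋁-cong (λ y → cong (f x y ·_) (g≐g′ y z))

  ∘R-cong : ∀ {X Y Z} {g g′ : Hom Y Z} {f f′ : Hom X Y} → g ≐ g′ → f ≐ f′ → (g ∘R f) ≐ (g′ ∘R f′)
  ∘R-cong {g′ = g′} {f = f} g≐g′ f≐f′ x z = trans (∘R-congʳ f g≐g′ x z) (∘R-congˡ g′ f≐f′ x z)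

  ∘R-assoc : ∀ {W X Y Z} (h : Hom Y Z) (g : Hom X Y) (f : Hom W X) →
             ((h ∘R g) ∘R f) ≐ (h ∘R (g ∘R f))
  ∘R-assoc h g f w z = begin
    ⋁ (λ x → f w x · ⋁ (λ y → g x y · h y z))    ≡⟨ ⋁-cong (λ x → ·-distribˡ-⋁ (f w x) _) ⟩
    ⋁ (λ x → ⋁ (λ y → f w x · (g x y · h y z)))  ≡⟨ ⋁-cong (λ x → ⋁-cong (λ y → sym (assoc _ _ _))) ⟩
    ⋁ (λ x → ⋁ (λ y → (f w x · g x y) · h y z))  ≡⟨ ⋁-swap _ ⟩
    ⋁ (λ y → ⋁ (λ x → (f w x · g x y) · h y z))  ≡⟨ ⋁-cong (λ y → sym (·-distribʳ-⋁ (h y z) _)) ⟩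
    ⋁ (λ y → ⋁ (λ x → f w x · g x y) · h y z)    ∎
    where open Relation.Binary.PropositionalEquality.≡-Reasoning

  graph : ∀ {X Y : Set} → (X → Y) → Hom X Y
  graph φ x y = ⟦ φ x ≡ y ⟧

  ∘R-graph : ∀ {X Y Z} (g : Hom Y Z) (φ : X → Y) x z → (g ∘R graph φ) x z ≡ g (φ x) z
  ∘R-graph g φ x z = trans (⋁-cong (λ y → ⟦⟧-·ˡ (φ x ≡ y) (g y z))) (⋁-onePoint (λ y → g y z))

  graph†-∘R : ∀ {W X Y} (φ : X → Y) (f : Hom W Y) w x → ((graph φ †) ∘R f) w x ≡ f w (φ x)
  graph†-∘R φ f w x = trans
    (⋁-cong (λ y → trans (cong (f w y ·_) (⟦⟧-* (φ x ≡ y))) (⟦⟧-·ʳ (φ x ≡ y) (f w y))))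
    (⋁-onePoint (f w))

  graph-∘R-graph† : ∀ {X Y} (φ : X → Y) x y →
                    (graph φ ∘R (graph φ †)) x y ≡ ⟦ Σ X (λ u → φ u ≡ x × φ u ≡ y) ⟧
  graph-∘R-graph† φ x y = trans
    (⋁-cong (λ u → trans (cong (_· ⟦ φ u ≡ y ⟧) (⟦⟧-* (φ u ≡ x))) (⟦⟧-·-⟦⟧ (φ u ≡ x) (φ u ≡ y))))
    (⋁-Σ (λ _ _ → 1Q))

  ∘R-identityʳ : ∀ {X Y} (f : Hom X Y) → (f ∘R idR X) ≐ f
  ∘R-identityʳ f = ∘R-graph f (λ x → x)

  ∘R-identityˡ : ∀ {X Y} (f : Hom X Y) → (idR Y ∘R f) ≐ f
  ∘R-identityˡ f x z = trans
    (⋁-cong (λ y → cong (f x y ·_) (trans (⟦⟧-cong (mk⇔ sym sym)) (sym (⟦⟧-* (z ≡ y))))))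
    (graph†-∘R (λ y → y) f x z)

  restrictHom : ∀ {E A : Set} → (E → A) → Hom A A → Hom E E
  restrictHom φ k u v = k (φ u) (φ v)

  restrictSub : ∀ {E A : Set} → (E → A) → Sub A → Sub E
  restrictSub φ S h = Σ (Hom _ _) (λ g → S g × h ≐ restrictHom φ g)

  restrictHom-cong : ∀ {E A} (φ : E → A) {k k′ : Hom A A} → k ≐ k′ → restrictHom φ k ≐ restrictHom φ k′
  restrictHom-cong φ k≐k′ u v = k≐k′ (φ u) (φ v)

  restrictHom-idR : ∀ {E A} {φ : E → A} → Injective _≡_ _≡_ φ → restrictHom φ (idR A) ≐ idR E
  restrictHom-idR φ-injective u v = ⟦⟧-cong (mk⇔ φ-injective (cong _))

  restrictHom-≐ : ∀ {E A} (φ : E → A) (k : Hom A A) →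
                  restrictHom φ k ≐ ((graph φ †) ∘R (k ∘R graph φ))
  restrictHom-≐ φ k u v = sym (trans (graph†-∘R φ (k ∘R graph φ) u v) (∘R-graph k φ u (φ v)))

  -- e is the partial identity on the image of φ.
  module Corner {A E : Set} (φ : E → A) (φ-injective : Injective _≡_ _≡_ φ)
                (e : Hom A A) (e-split : e ≐ (graph φ ∘R (graph φ †))) where

    private
      ι : Hom E A
      ι = graph φ

      ι† : Hom A E
      ι† = graph φ †

      restr : Hom A A → Hom E E
      restr = restrictHom φ

    open ≐-Reasoning

    ι-isometry : (ι† ∘R ι) ≐ idR E
    ι-isometry u v = trans (graph†-∘R φ ι u v) (restrictHom-idR φ-injective u v)

    ι†-∘R-e : (ι† ∘R e) ≐ ι†
    ι†-∘R-e = begin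
      ι† ∘R e            ≈⟨ ∘R-congˡ ι† e-split ⟩
      ι† ∘R (ι ∘R ι†)    ≈⟨ ∘R-assoc ι† ι ι† ⟨
      (ι† ∘R ι) ∘R ι†    ≈⟨ ∘R-congʳ ι† ι-isometry ⟩
      idR E ∘R ι†        ≈⟨ ∘R-identityˡ ι† ⟩
      ι†                 ∎

    e-∘R-ι : (e ∘R ι) ≐ ι
    e-∘R-ι = begin
      e ∘R ι             ≈⟨ ∘R-congʳ ι e-split ⟩
      (ι ∘R ι†) ∘R ι     ≈⟨ ∘R-assoc ι ι† ι ⟩
      ι ∘R (ι† ∘R ι)     ≈⟨ ∘R-congˡ ι ι-isometry ⟩
      ι ∘R idR E         ≈⟨ ∘R-identityʳ ι ⟩
      ι                  ∎

    restrictHom-e∘R : ∀ k → restr (e ∘R k) ≐ restr k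
    restrictHom-e∘R k = begin
      restr (e ∘R k)            ≈⟨ restrictHom-≐ φ (e ∘R k) ⟩
      ι† ∘R ((e ∘R k) ∘R ι)     ≈⟨ ∘R-congˡ ι† (∘R-assoc e k ι) ⟩
      ι† ∘R (e ∘R (k ∘R ι))     ≈⟨ ∘R-assoc ι† e (k ∘R ι) ⟨
      (ι† ∘R e) ∘R (k ∘R ι)     ≈⟨ ∘R-congʳ (k ∘R ι) ι†-∘R-e ⟩
      ι† ∘R (k ∘R ι)            ≈⟨ restrictHom-≐ φ k ⟨
      restr k                   ∎

    module _ {k : Hom A A} (k-e : (k ∘R e) ≐ (e ∘R k)) where

      ι-intertwines : (k ∘R ι) ≐ (ι ∘R restr k)
      ι-intertwines = begin
        k ∘R ι                    ≈⟨ ∘R-congˡ k e-∘R-ι ⟨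
        k ∘R (e ∘R ι)             ≈⟨ ∘R-assoc k e ι ⟨
        (k ∘R e) ∘R ι             ≈⟨ ∘R-congʳ ι k-e ⟩
        (e ∘R k) ∘R ι             ≈⟨ ∘R-assoc e k ι ⟩
        e ∘R (k ∘R ι)             ≈⟨ ∘R-congʳ (k ∘R ι) e-split ⟩
        (ι ∘R ι†) ∘R (k ∘R ι)     ≈⟨ ∘R-assoc ι ι† (k ∘R ι) ⟩
        ι ∘R (ι† ∘R (k ∘R ι))     ≈⟨ ∘R-congˡ ι (restrictHom-≐ φ k) ⟨
        ι ∘R restr k              ∎

      ι†-intertwines : (ι† ∘R k) ≐ (restr k ∘R ι†)
      ι†-intertwines = begin
        ι† ∘R k                   ≈⟨ ∘R-congʳ k ι†-∘R-e ⟨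
        (ι† ∘R e) ∘R k            ≈⟨ ∘R-assoc ι† e k ⟩
        ι† ∘R (e ∘R k)            ≈⟨ ∘R-congˡ ι† k-e ⟨
        ι† ∘R (k ∘R e)            ≈⟨ ∘R-congˡ ι† (∘R-congˡ k e-split) ⟩
        ι† ∘R (k ∘R (ι ∘R ι†))    ≈⟨ ∘R-congˡ ι† (∘R-assoc k ι ι†) ⟨
        ι† ∘R ((k ∘R ι) ∘R ι†)    ≈⟨ ∘R-assoc ι† (k ∘R ι) ι† ⟨
        (ι† ∘R (k ∘R ι)) ∘R ι†    ≈⟨ ∘R-congʳ ι† (restrictHom-≐ φ k) ⟨
        restr k ∘R ι†             ∎

      restrictHom-∘R : ∀ g → restr (g ∘R k) ≐ (restr g ∘R restr k)
      restrictHom-∘R g = begin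
        restr (g ∘R k)                    ≈⟨ restrictHom-≐ φ (g ∘R k) ⟩
        ι† ∘R ((g ∘R k) ∘R ι)             ≈⟨ ∘R-congˡ ι† (∘R-assoc g k ι) ⟩
        ι† ∘R (g ∘R (k ∘R ι))             ≈⟨ ∘R-congˡ ι† (∘R-congˡ g ι-intertwines) ⟩
        ι† ∘R (g ∘R (ι ∘R restr k))       ≈⟨ ∘R-congˡ ι† (∘R-assoc g ι (restr k)) ⟨
        ι† ∘R ((g ∘R ι) ∘R restr k)       ≈⟨ ∘R-assoc ι† (g ∘R ι) (restr k) ⟨
        (ι† ∘R (g ∘R ι)) ∘R restr k       ≈⟨ ∘R-congʳ (restr k) (restrictHom-≐ φ g) ⟨
        restr g ∘R restr k                ∎

    restrictHom-commute : ∀ {f k} → (f ∘R e) ≐ (e ∘R f) → (k ∘R e) ≐ (e ∘R k) →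
                          (f ∘R k) ≐ (k ∘R f) → (restr f ∘R restr k) ≐ (restr k ∘R restr f)
    restrictHom-commute {f} {k} f-e k-e f-k = begin
      restr f ∘R restr k    ≈⟨ restrictHom-∘R k-e f ⟨
      restr (f ∘R k)        ≈⟨ restrictHom-cong φ f-k ⟩
      restr (k ∘R f)        ≈⟨ restrictHom-∘R f-e k ⟩
      restr k ∘R restr f    ∎

    extend : Hom E E → Hom A A
    extend h = ι ∘R (h ∘R ι†)

    restrictHom-extend : ∀ h → restr (extend h) ≐ h
    restrictHom-extend h = begin
      restr (extend h)                   ≈⟨ restrictHom-≐ φ (extend h) ⟩
      ι† ∘R ((ι ∘R (h ∘R ι†)) ∘R ι)      ≈⟨ ∘R-congˡ ι† (∘R-assoc ι (h ∘R ι†) ι) ⟩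
      ι† ∘R (ι ∘R ((h ∘R ι†) ∘R ι))      ≈⟨ ∘R-assoc ι† ι ((h ∘R ι†) ∘R ι) ⟨
      (ι† ∘R ι) ∘R ((h ∘R ι†) ∘R ι)      ≈⟨ ∘R-congʳ ((h ∘R ι†) ∘R ι) ι-isometry ⟩
      idR E ∘R ((h ∘R ι†) ∘R ι)          ≈⟨ ∘R-identityˡ ((h ∘R ι†) ∘R ι) ⟩
      (h ∘R ι†) ∘R ι                     ≈⟨ ∘R-assoc h ι† ι ⟩
      h ∘R (ι† ∘R ι)                     ≈⟨ ∘R-congˡ h ι-isometry ⟩
      h ∘R idR E                         ≈⟨ ∘R-identityʳ h ⟩
      h                                  ∎

    extend-commutes : ∀ {h k} → (k ∘R e) ≐ (e ∘R k) → (h ∘R restr k) ≐ (restr k ∘R h) →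
                      (extend h ∘R k) ≐ (k ∘R extend h)
    extend-commutes {h} {k} k-e h-k = begin
      (ι ∘R (h ∘R ι†)) ∘R k       ≈⟨ ∘R-assoc ι (h ∘R ι†) k ⟩
      ι ∘R ((h ∘R ι†) ∘R k)       ≈⟨ ∘R-congˡ ι (∘R-assoc h ι† k) ⟩
      ι ∘R (h ∘R (ι† ∘R k))       ≈⟨ ∘R-congˡ ι (∘R-congˡ h (ι†-intertwines k-e)) ⟩
      ι ∘R (h ∘R (r ∘R ι†))       ≈⟨ ∘R-congˡ ι (∘R-assoc h r ι†) ⟨
      ι ∘R ((h ∘R r) ∘R ι†)       ≈⟨ ∘R-congˡ ι (∘R-congʳ ι† h-k) ⟩
      ι ∘R ((r ∘R h) ∘R ι†)       ≈⟨ ∘R-congˡ ι (∘R-assoc r h ι†) ⟩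
      ι ∘R (r ∘R (h ∘R ι†))       ≈⟨ ∘R-assoc ι r (h ∘R ι†) ⟨
      (ι ∘R r) ∘R (h ∘R ι†)       ≈⟨ ∘R-congʳ (h ∘R ι†) (ι-intertwines k-e) ⟨
      (k ∘R ι) ∘R (h ∘R ι†)       ≈⟨ ∘R-assoc k ι (h ∘R ι†) ⟩
      k ∘R (ι ∘R (h ∘R ι†))       ∎
      where
      r : Hom E E
      r = restr k

    module _ {𝐀 : Sub A} (V : IsVNAlg A 𝐀) (e∈𝐀 : 𝐀 e) where
      open IsVNAlg V

      private
        𝐁 : Sub E
        𝐁 = restrictSub φ 𝐀

      restrictHom-∈-commutant : ∀ k → (𝐀 ′) k → (𝐁 ′) (restr k)
      restrictHom-∈-commutant k k∈𝐀′ h (f , f∈𝐀 , h≐f) = begin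
        restr k ∘R h         ≈⟨ ∘R-congˡ (restr k) h≐f ⟩
        restr k ∘R restr f   ≈⟨ restrictHom-commute (k∈𝐀′ e e∈𝐀) (commutative f e f∈𝐀 e∈𝐀)
                                  (k∈𝐀′ f f∈𝐀) ⟩
        restr f ∘R restr k   ≈⟨ ∘R-congʳ (restr k) h≐f ⟨
        h ∘R restr k         ∎

      restrictSub-isVNAlg : IsVNAlg E 𝐁
      restrictSub-isVNAlg = record
        { zero∈ = zeroR , zero∈ , (λ _ _ → refl)
        ; id∈ = idR A , id∈ , (λ u v → sym (restrictHom-idR φ-injective u v))
        ; ⊹-closed = λ { _ _ (f , f∈ , ≐f) (g , g∈ , ≐g) →
            f ⊹ g , ⊹-closed f g f∈ g∈ , (λ u v → cong₂ _∨_ (≐f u v) (≐g u v)) }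
        ; ∘-closed = λ { _ _ (f , f∈ , ≐f) (g , g∈ , ≐g) →
            g ∘R f , ∘-closed f g f∈ g∈ ,
            ≐-trans (∘R-cong ≐g ≐f) (≐-sym (restrictHom-∘R (commutative f e f∈ e∈𝐀) g)) }
        ; ⊙-closed = λ { q _ (f , f∈ , ≐f) → q ⊙ f , ⊙-closed q f f∈ , (λ u v → cong (q ·_) (≐f u v)) }
        ; †-closed = λ { _ (f , f∈ , ≐f) → f † , †-closed f f∈ , (λ u v → cong _* (≐f v u)) }
        ; commutative = λ { _ _ (f , f∈ , ≐f) (g , g∈ , ≐g) →
            ≐-trans (∘R-cong ≐f ≐g)
              (≐-trans (restrictHom-commute (commutative f e f∈ e∈𝐀) (commutative g e g∈ e∈𝐀)
                          (commutative f g f∈ g∈))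
                       (≐-sym (∘R-cong ≐g ≐f))) }
        ; bicommutant⊆ = ⊆-bicommutant
        ; bicommutant⊇ = λ h h∈𝐁″ →
            extend h ,
            bicommutant⊇ (extend h) (λ k k∈𝐀′ → extend-commutes (k∈𝐀′ e e∈𝐀)
              (h∈𝐁″ (restr k) (restrictHom-∈-commutant k k∈𝐀′))) ,
            ≐-sym (restrictHom-extend h)
        }
        where open Setoid (≐-setoid E E) using () renaming (trans to ≐-trans; sym to ≐-sym)

proj₁-injective : ∀ {A : Set} {E : A → Set} → (∀ x (p q : E x) → p ≡ q) →
                  Injective _≡_ _≡_ (proj₁ {B = E})
proj₁-injective E-prop {x , p} {.x , q} refl = cong (x ,_) (E-prop x p q)

lemma34 : (Q : CIQuantale) → let open RelQ Q in
    (A : Set) (𝐀 : Sub A) → IsVNAlg A 𝐀 →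
    (E : A → Set) → (∀ x (p q : E x) → p ≡ q) →
    (e₁ e₂ : Hom A A) → 𝐀 e₁ → 𝐀 e₂ →
    (e₁ ∘R e₁) ≐ e₁ → (e₂ ∘R e₂) ≐ e₂ →
    (e₁ ∘R e₂) ≐ zeroR → (e₂ ∘R e₁) ≐ zeroR →
    (e₁ ⊹ e₂) ≐ idR A →
    (∀ x y → e₁ x y ≡ ⋁ {(x ≡ y) × E x} (λ _ → 1Q)) →
    IsDirectSum 𝐀 e₁ e₂ →
    IsVNAlg (Σ A E) (restrict E (e₁ ·Sub 𝐀))
lemma34 Q A 𝐀 V E E-prop e₁ _ e₁∈𝐀 _ _ _ _ _ _ e₁-shape _ =
  IsVNAlg-cong restrictSub⊆ ⊆restrictSub (restrictSub-isVNAlg V e₁∈𝐀)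
  where
  open Relations Q

  e₁-split : e₁ ≐ (graph proj₁ ∘R (graph proj₁ †))
  e₁-split x y = trans (e₁-shape x y) (trans (⟦⟧-cong image-diagonal) (sym (graph-∘R-graph† proj₁ x y)))
    where
    image-diagonal : ((x ≡ y) × E x) ⇔ Σ (Σ A E) (λ u → proj₁ u ≡ x × proj₁ u ≡ y)
    image-diagonal = mk⇔ (λ { (refl , p) → (x , p) , refl , refl })
                         (λ { ((_ , p) , refl , refl) → refl , p })

  open Corner proj₁ (proj₁-injective E-prop) e₁ e₁-split

  restrictSub⊆ : ∀ h → restrictSub proj₁ 𝐀 h → restrict E (e₁ ·Sub 𝐀) h
  restrictSub⊆ h (f , f∈𝐀 , h≐f) =
    e₁ ∘R f , (f , f∈𝐀 , λ _ _ → refl) , (λ u v → trans (h≐f u v) (sym (restrictHom-e∘R f u v)))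

  ⊆restrictSub : ∀ h → restrict E (e₁ ·Sub 𝐀) h → restrictSub proj₁ 𝐀 h
  ⊆restrictSub h (_ , (f , f∈𝐀 , g≐e₁f) , h≐g) =
    f , f∈𝐀 , (λ u v → trans (h≐g u v) (trans (g≐e₁f _ _) (restrictHom-e∘R f u v)))
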